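{- Let $p$ be an odd prime, let $\lambda=(\lambda_1,\dots,\lambda_r)$ be a BG-partition, and let $k=k(\lambda)$. Then the partition $\mu=(\lambda_1,\lambda_2,\dots,\lambda_k)$ is $p$-regular.
   Context: A partition is a weakly decreasing sequence of nonnegative integers with finitely many nonzero parts; $\lambda'$ denotes the conjugate; self-conjugate means $\lambda=\lambda'$. $k(\lambda)=\max\{i:\lambda_i\geq i\}$; $h^\lambda_{ij}=\lambda_i+\lambda'_j-i-j+1$. A BG-partition is a self-conjugate $\lambda$ with $p\nmid h^\lambda_{ii}$ for all $1\leq i\leq k(\lambda)$. A partition is $p$-regular if it has no $p$ equal nonzero parts. -}

module Defs where

open import Data.Nat using (ℕ; zero; suc; _+_; _∸_; _≤_; _<_; _≥_; _≤ᵇ_; _≡ᵇ_)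
open import Data.Nat.Divisibility using (_∣_)
open import Data.List using (List; []; _∷_; length; take; filter)
open import Data.List.Relation.Unary.All using (All)
open import Data.List.Relation.Unary.Linked using (Linked)
open import Data.Bool using (T)
open import Relation.Nullary using (¬_)
open import Relation.Binary.PropositionalEquality using (_≡_)
open import Data.Product using (∃; _×_)
open import Data.Sum using (_⊎_)
open import Data.Nat.Properties using (_≟_)

record Partition : Set where
  constructor mkPartition
  field
    parts    : List ℕ
    positive : All (λ x → 1 ≤ x) parts
    decr     : Linked (λ a b → b ≤ a) parts
open Partition public

-- 1-indexed part λ_i (λ_i = 0 for i = 0 or i > r; index 0 is never used).
nth : List ℕ → ℕ → ℕ
nth []       _             = 0
nth (x ∷ xs) zero          = 0
nth (x ∷ xs) (suc zero)    = x
nth (x ∷ xs) (suc (suc i)) = nth xs (suc i)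

part : Partition → ℕ → ℕ
part μ i = nth (parts μ) i

conjPart : Partition → ℕ → ℕ
conjPart μ j = length (filter (λ x → j Data.Nat.≤? x) (parts μ))

SelfConjugate : Partition → Set
SelfConjugate μ = ∀ j → 1 ≤ j → conjPart μ j ≡ part μ j

hook : Partition → ℕ → ℕ → ℕ
hook μ i j = ((part μ i + conjPart μ j + 1) ∸ i) ∸ j

-- k is k(λ) = max { i ≥ 1 : λ_i ≥ i }  (with max ∅ = 0)
IsDurfee : Partition → ℕ → Set
IsDurfee μ k =
  (k ≡ 0 ⊎ (1 ≤ k × k ≤ part μ k)) ×
  (∀ i → 1 ≤ i → i ≤ part μ i → i ≤ k)

BG : ℕ → Partition → Set
BG p μ = SelfConjugate μ ×
  (∀ k → IsDurfee μ k → ∀ i → 1 ≤ i → i ≤ k → ¬ (p ∣ hook μ i i))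

PRegular : ℕ → List ℕ → Set
PRegular p xs = ∀ v → 1 ≤ v → length (filter (λ x → v ≟ x) xs) < p

module Submission where

-- Write the odd prime as p = 2q+1 and suppose some value v
-- occurs p times among λ₁,…,λ_k.  Since the parts are weakly decreasing,
-- λ_i = v on a whole window a ≤ i ≤ a+2q of p consecutive rows inside the
-- Durfee square, and v ≥ k ≥ a+2q because λ_k ≥ k.  For a self-conjugate
-- partition the diagonal hook is h_ii = 2(λ_i − i) + 1, so along the window
-- the diagonal hooks run through the p consecutive odd numbers
-- 2(v−a−2q)+1, …, 2(v−a)+1, and p odd divides one of them — contradicting
-- the BG condition.

open import Defs
open import Data.Nat using (ℕ; zero; suc; _+_; _*_; _∸_; _≤_; _<_; z≤n; s≤s; s≤s⁻¹)
open import Data.Nat.Properties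
open import Data.Nat.DivMod using (_%_; _/_; m≡m%n+[m/n]*n; m%n<n)
open import Data.Nat.Divisibility using (_∣_; divides; ∣m∣n⇒∣m+n)
open import Data.Nat.Primality using (Prime; prime⇒irreducible)
open import Data.List using (List; []; _∷_; take; length; filter)
open import Data.List.Properties using (length-take; filter-accept; filter-reject)
open import Data.List.Relation.Unary.Linked using (Linked; []; [-]; _∷_)
open import Data.Product using (∃; _×_; _,_)
open import Data.Sum using (inj₁; inj₂)
open import Data.Empty using (⊥-elim)
open import Relation.Nullary using (¬_; yes; no)
open import Relation.Binary.PropositionalEquality
open import Data.Nat.Tactic.RingSolver using (solve-∀)

oddPrime : ∀ p → Prime p → ¬ (p ≡ 2) → ∃ λ q → p ≡ suc (q + q)
oddPrime p pr p≢2 with p % 2 | m%n<n p 2 | m≡m%n+[m/n]*n p 2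
... | 1 | _ | p≡ = q , trans p≡ (cong suc (trans (*-comm q 2) (cong (q +_) (+-identityʳ q))))
  where q = p / 2
... | suc (suc _) | s≤s (s≤s ()) | _
... | 0 | _ | p≡ with prime⇒irreducible pr {2} (divides (p / 2) p≡)
...   | inj₁ ()
...   | inj₂ 2≡p = ⊥-elim (p≢2 (sym 2≡p))

-- Among the p = 2q+1 consecutive odd numbers 2(m+t)+1, 0 ≤ t ≤ 2q, one is a
-- multiple of p.  Shifting m by one shifts the window; when the multiple
-- leaves it at the bottom, adding 2p brings one back in at the top.
oddMultipleInWindow : ∀ q m → ∃ λ t → t ≤ q + q × suc (q + q) ∣ suc ((m + t) + (m + t))
oddMultipleInWindow q zero = q , m≤m+n q q , divides 1 (sym (+-identityʳ _))
oddMultipleInWindow q (suc m) with oddMultipleInWindow q m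
... | suc t , t<2q , p∣ =
  t , ≤-trans (n≤1+n t) t<2q , subst (λ n → suc (q + q) ∣ suc (n + n)) (+-suc m t) p∣
... | zero  , _     , p∣ =
  q + q , ≤-refl , subst (suc (q + q) ∣_) (addTwoP m (q + q)) (∣m∣n⇒∣m+n p∣ (divides 2 refl))
  where
  addTwoP : ∀ m c → suc ((m + 0) + (m + 0)) + 2 * suc c ≡ suc ((suc m + c) + (suc m + c))
  addTwoP = solve-∀

count : ℕ → List ℕ → ℕ
count v xs = length (filter (v ≟_) xs)

count-hit : ∀ v ys → count v (v ∷ ys) ≡ suc (count v ys)
count-hit v ys = cong length (filter-accept (v ≟_) {v} {ys} refl)

count-miss : ∀ {v y ys} → ¬ v ≡ y → count v (y ∷ ys) ≡ count v ys
count-miss {v} {y} {ys} v≢y = cong length (filter-reject (v ≟_) {y} {ys} v≢y)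

spreadOccurrences : ∀ v c ys → c < count v ys →
  ∃ λ a → ∃ λ b → a + c ≤ b × b < length ys × nth ys (suc a) ≡ v × nth ys (suc b) ≡ v
spreadOccurrences v c [] ()
spreadOccurrences v c (y ∷ ys) c<n with v ≟ y
spreadOccurrences v zero (y ∷ ys) _ | yes refl = 0 , 0 , z≤n , s≤s z≤n , refl , refl
spreadOccurrences v (suc c) (y ∷ ys) c<n | yes refl
  with spreadOccurrences v c ys (s≤s⁻¹ (subst (suc (suc c) ≤_) (count-hit v ys) c<n))
... | a , b , a+c≤b , b<n , _ , ys[b]≡v =
  0 , suc b , s≤s (≤-trans (m≤n+m c a) a+c≤b) , s≤s b<n , refl , ys[b]≡v
spreadOccurrences v c (y ∷ ys) c<n | no v≢y
  with spreadOccurrences v c ys (subst (suc c ≤_) (count-miss v≢y) c<n)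
... | a , b , a+c≤b , b<n , ys[a]≡v , ys[b]≡v =
  suc a , suc b , s≤s a+c≤b , s≤s b<n , ys[a]≡v , ys[b]≡v

nth-take : ∀ xs k i → i ≤ k → nth (take k xs) i ≡ nth xs i
nth-take []       zero    i             _         = refl
nth-take []       (suc k) i             _         = refl
nth-take (x ∷ xs) zero    zero          _         = refl
nth-take (x ∷ xs) (suc k) zero          _         = refl
nth-take (x ∷ xs) (suc k) (suc zero)    _         = refl
nth-take (x ∷ xs) (suc k) (suc (suc i)) (s≤s i≤k) = nth-take xs k (suc i) i≤k

spreadOccurrencesInPrefix : ∀ {v c} xs k → c < count v (take k xs) →
  ∃ λ a → ∃ λ b → a + c ≤ b × suc b ≤ k × nth xs (suc a) ≡ v × nth xs (suc b) ≡ v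
spreadOccurrencesInPrefix {v} {c} xs k c<n
  with spreadOccurrences v c (take k xs) c<n
... | a , b , a+c≤b , b<len , xs[a]≡v , xs[b]≡v =
  a , b , a+c≤b , 1+b≤k ,
  trans (sym (nth-take xs k (suc a) (≤-trans (s≤s (≤-trans (m≤m+n a c) a+c≤b)) 1+b≤k))) xs[a]≡v ,
  trans (sym (nth-take xs k (suc b) 1+b≤k)) xs[b]≡v
  where
  1+b≤k : suc b ≤ k
  1+b≤k = ≤-trans b<len (subst (_≤ k) (sym (length-take k xs)) (m⊓n≤m k _))

Decreasing : List ℕ → Set
Decreasing = Linked (λ a b → b ≤ a)

-- The entries of a weakly decreasing list decrease along positions
-- (positions 1+i ≤ 1+j, written 0-based so no side condition i ≥ 1 is needed).
nth-antitone : ∀ {xs} → Decreasing xs → ∀ {i j} → i ≤ j → nth xs (suc j) ≤ nth xs (suc i)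
nth-antitone []                               _         = z≤n
nth-antitone {_ ∷ _} _            {zero}  {zero}  _         = ≤-refl
nth-antitone [-]                  {zero}  {suc j} _         = z≤n
nth-antitone (y≤x ∷ decr)         {zero}  {suc j} _         = ≤-trans (nth-antitone decr {0} {j} z≤n) y≤x
nth-antitone [-]                  {suc i} {suc j} _         = z≤n
nth-antitone (_ ∷ decr)           {suc i} {suc j} (s≤s i≤j) = nth-antitone decr i≤j

nth-constant : ∀ {xs} → Decreasing xs → ∀ {a i b v} → a ≤ i → i ≤ b →
  nth xs (suc a) ≡ v → nth xs (suc b) ≡ v → nth xs (suc i) ≡ v
nth-constant decr a≤i i≤b refl xs[b]≡v =
  ≤-antisym (nth-antitone decr a≤i) (subst (_≤ _) xs[b]≡v (nth-antitone decr i≤b))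

-- For a self-conjugate partition λ'_i = λ_i, so the diagonal hook
-- h_ii = 2(λ_i − i) + 1 is odd; here λ_{1+i} = (1+i) + d.
hook-diagonal : ∀ {μ} → SelfConjugate μ → ∀ {i d} → part μ (suc i) ≡ suc i + d →
  hook μ (suc i) (suc i) ≡ suc (d + d)
hook-diagonal {μ} selfConj {i} {d} λᵢ≡ = begin
  (part μ (suc i) + conjPart μ (suc i) + 1 ∸ suc i) ∸ suc i
    ≡⟨ cong (λ c → (part μ (suc i) + c + 1 ∸ suc i) ∸ suc i) (selfConj (suc i) (s≤s z≤n)) ⟩
  (part μ (suc i) + part μ (suc i) + 1 ∸ suc i) ∸ suc i
    ≡⟨ cong (λ l → (l + l + 1 ∸ suc i) ∸ suc i) λᵢ≡ ⟩
  (suc i + d + (suc i + d) + 1 ∸ suc i) ∸ suc i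
    ≡⟨ cong (λ n → (n ∸ suc i) ∸ suc i) (regroup (suc i) d) ⟩
  (suc i + (suc i + suc (d + d)) ∸ suc i) ∸ suc i
    ≡⟨ cong (_∸ suc i) (m+n∸m≡n (suc i) _) ⟩
  (suc i + suc (d + d)) ∸ suc i
    ≡⟨ m+n∸m≡n (suc i) _ ⟩
  suc (d + d) ∎
  where
  open ≡-Reasoning
  regroup : ∀ j d → j + d + (j + d) + 1 ≡ j + (j + suc (d + d))
  regroup = solve-∀

-- Every row of the Durfee square is at least as long as the square is wide:
-- i ≤ k implies λ_i ≥ λ_k ≥ k.
durfeeRow : ∀ {μ k} → IsDurfee μ k → ∀ {i} → suc i ≤ k → k ≤ part μ (suc i)
durfeeRow {μ} (inj₂ (_ , k≤λₖ) , _) {i} (s≤s i≤k′) =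
  ≤-trans k≤λₖ (nth-antitone (decr μ) i≤k′)

-- Core step: in a self-conjugate partition, a run of equal parts
-- λ_{1+a} = … = λ_{1+b} = v of length at least p = 2q+1 (b ≥ a + 2q) whose
-- rows all meet the diagonal (1+b ≤ v) contains a row 1+i, i ≤ b, whose
-- diagonal hook is divisible by p.  The hooks along the run are the odd
-- numbers 2(v−1−i)+1, and the run covers p consecutive values of i.
longRunDivisibleHook : ∀ {μ} → SelfConjugate μ → ∀ q {a b v} → a + (q + q) ≤ b → suc b ≤ v →
  part μ (suc a) ≡ v → part μ (suc b) ≡ v →
  ∃ λ i → i ≤ b × suc (q + q) ∣ hook μ (suc i) (suc i)
longRunDivisibleHook {μ} selfConj q {a} {b} a+2q≤b 1+b≤v partₐ≡v part_b≡v
  with m≤n⇒∃[o]m+o≡n (≤-trans (s≤s a+2q≤b) 1+b≤v)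
... | m , refl with oddMultipleInWindow q m
... | t , t≤2q , p∣ with m≤n⇒∃[o]m+o≡n t≤2q
... | s , t+s≡2q = a + s , a+s≤b , subst (suc (q + q) ∣_) (sym hookᵢ) p∣
  where
  a+s≤b : a + s ≤ b
  a+s≤b = ≤-trans (+-monoʳ-≤ a (subst (s ≤_) t+s≡2q (m≤n+m s t))) a+2q≤b
  v≡ : suc (a + (q + q)) + m ≡ suc (a + s) + (m + t)
  v≡ = begin
    suc (a + (q + q)) + m ≡⟨ cong (λ c → suc (a + c) + m) (sym t+s≡2q) ⟩
    suc (a + (t + s)) + m ≡⟨ cong suc (shuffle a t s m) ⟩
    suc (a + s) + (m + t) ∎
    where
    open ≡-Reasoning
    shuffle : ∀ a t s m → a + (t + s) + m ≡ a + s + (m + t)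
    shuffle = solve-∀
  hookᵢ : hook μ (suc (a + s)) (suc (a + s)) ≡ suc ((m + t) + (m + t))
  hookᵢ = hook-diagonal {μ} selfConj
    (trans (nth-constant (decr μ) (m≤m+n a s) a+s≤b partₐ≡v part_b≡v) v≡)

lemma3p18 : (p : ℕ) → Prime p → ¬ (p ≡ 2) → (μ : Partition) → BG p μ →
    (k : ℕ) → IsDurfee μ k → PRegular p (take k (parts μ))
lemma3p18 p pr p≢2 μ (selfConj , bg) k durfee v _ with oddPrime p pr p≢2
... | q , refl with count v (take k (parts μ)) <? suc (q + q)
... | yes fewer = fewer
... | no notFewer with spreadOccurrencesInPrefix (parts μ) k (≮⇒≥ notFewer)
... | a , b , a+2q≤b , 1+b≤k , partₐ≡v , part_b≡v
  with longRunDivisibleHook {μ} selfConj q a+2q≤b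
         (≤-trans 1+b≤k (subst (k ≤_) part_b≡v (durfeeRow {μ} durfee 1+b≤k))) partₐ≡v part_b≡v
... | i , i≤b , p∣hook =
  ⊥-elim (bg k durfee (suc i) (s≤s z≤n) (≤-trans (s≤s i≤b) 1+b≤k) p∣hook)
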